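{- Let $n\ge3$ and $A\in\mathscr S^*(n)$ with parameters $c=c(A)$, $v=v(A)$, $s=s(A)$, $\bar c=c(\bar A)$, $\bar v=v(\bar A)$, $\bar s=s(\bar A)$, and let $E=(2c-v-1)^2+4s$, $F=(2\bar c-\bar v-1)^2+4\bar s$, and $$g(x)=(2x-v-\bar v+2)^2\big((2x-v-\bar v+2)^2-2(E+F)\big)+(E-F)^2.$$ If $c+\bar c\ge(4n-5)/3$, $v=n-\bar c$ and $\bar v=n-c-1$, then $g$ is increasing on the interval $[(4n-5)/3,\infty)$.
   Context: $\mathscr S(n)$ is the set of $n\times n$ $(0,1)$-matrices with zero diagonal. $\mathscr S^*(n)$ is the set of $A=(a_{ij})\in\mathscr S(n)$ with $a_{12}=a_{21}=1$, $a_{n-1,n}=a_{n,n-1}=0$, and such that whenever $a_{ij}=1$, also $a_{hk}=1$ for all $h\le i$, $k\le j$ with $h\neq k$. For $A\in\mathscr S^*(n)$ with row sums $r_1,\dots,r_n$: $c(A)=\max\{i\in[n]: r_1+\cdots+r_i>i(i-1)\}$, $v(A)=r_{c(A)+1}$, $s(A)=\sum_{i=1}^{c(A)}r_i-c(A)(c(A)-1)$. For $A=(a_{ij})\in\mathscr S^*(n)$, $\bar A=(\bar a_{ij})$ is the $n\times n$ matrix with zero diagonal and $\bar a_{ij}=1-a_{n-j+1,n-i+1}$ for $i\neq j$; it again lies in $\mathscr S^*(n)$.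
   Formalization: Monotonicity of g is asserted only for rational points of the interval $[(4n-5)/3,\infty)$. -}

module Defs where

open import Data.Bool using (Bool; true; false; if_then_else_; not)
open import Data.Nat as ℕ using (ℕ; zero; suc; _∸_; _<?_; _<ᵇ_)
open import Data.Fin as Fin using (Fin; toℕ; opposite; fromℕ<)
open import Data.Fin.Properties using (_≟_)
open import Data.List using (List; map; allFin)
open import Data.Nat.ListAction using (sum)
open import Data.Integer as ℤ using (ℤ; +_)
open import Data.Rational as ℚ using (ℚ; _/_)
open import Relation.Binary.PropositionalEquality using (_≡_; _≢_)
open import Relation.Nullary using (yes; no; does)

-- Matrices: A i j with 0-based indices (Fin n); entry 1 ↔ true.
Mat : ℕ → Set
Mat n = Fin n → Fin n → Bool

b2n : Bool → ℕ
b2n true  = 1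
b2n false = 0

-- membership in 𝒮*(n) (0-based indices: paper's (1,2) is (0,1), (n-1,n) is (n-2,n-1))
record InSStar (n : ℕ) (A : Mat n) : Set where
  field
    zeroDiag : ∀ i → A i i ≡ false
    a12      : ∀ i j → toℕ i ≡ 0 → toℕ j ≡ 1 → A i j ≡ true
    a21      : ∀ i j → toℕ i ≡ 1 → toℕ j ≡ 0 → A i j ≡ true
    an-1n    : ∀ i j → suc (suc (toℕ i)) ≡ n → suc (toℕ j) ≡ n → A i j ≡ false
    ann-1    : ∀ i j → suc (toℕ i) ≡ n → suc (suc (toℕ j)) ≡ n → A i j ≡ false
    closed   : ∀ i j → A i j ≡ true → ∀ h k → h Fin.≤ i → k Fin.≤ j → h ≢ k → A h k ≡ true

-- row sum of 0-based row i (0 if i is out of range; never used out of range)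
rowSum : ∀ {n} → Mat n → ℕ → ℕ
rowSum {n} A i with i <? n
... | yes p = sum (map (λ j → b2n (A (fromℕ< p) j)) (allFin n))
... | no _  = 0

prefixSum : ∀ {n} → Mat n → ℕ → ℕ
prefixSum A zero    = 0
prefixSum A (suc i) = prefixSum A i ℕ.+ rowSum A i

maxSat : (ℕ → Bool) → ℕ → ℕ
maxSat p zero    = 0
maxSat p (suc k) = if p (suc k) then suc k else maxSat p k

cA : ∀ {n} → Mat n → ℕ
cA {n} A = maxSat (λ i → (i ℕ.* (i ∸ 1)) <ᵇ prefixSum A i) n

-- v(A) = r_{c(A)+1}  (paper's row c+1 is 0-based row c)
vA : ∀ {n} → Mat n → ℕ
vA A = rowSum A (cA A)

-- s(A) = r_1 + ⋯ + r_c - c(c-1)   (nonnegative by definition of c)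
sA : ∀ {n} → Mat n → ℕ
sA A = prefixSum A (cA A) ∸ (cA A ℕ.* (cA A ∸ 1))

-- Ā: zero diagonal, ā_ij = 1 - a_{n-j+1,n-i+1} (0-based: opposite indices)
bar : ∀ {n} → Mat n → Mat n
bar A i j with does (i ≟ j)
... | true  = false
... | false = not (A (opposite j) (opposite i))

q : ℕ → ℚ
q m = (+ m) / 1

EF : ℕ → ℕ → ℕ → ℚ
EF c v s = let t = q 2 ℚ.* q c ℚ.- q v ℚ.- q 1 in t ℚ.* t ℚ.+ q 4 ℚ.* q s

gfun : (v vb : ℕ) (E F : ℚ) → ℚ → ℚ
gfun v vb E F x =
  let u = q 2 ℚ.* x ℚ.- q v ℚ.- q vb ℚ.+ q 2
      d = E ℚ.- F
  in (u ℚ.* u) ℚ.* (u ℚ.* u ℚ.- q 2 ℚ.* (E ℚ.+ F)) ℚ.+ d ℚ.* d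

lowerBound : ℕ → ℚ
lowerBound n = (+ (4 ℕ.* n) ℤ.- + 5) / 3

{-# OPTIONS --safe #-}
module Submission where

-- Put u = 2x − v − v̄ + 2, so that g = u²(u² − 2(E+F)) + (E−F)². As a function of u², g is increasing
-- once u² ≥ E + F, and u is increasing in x; hence it suffices that u ≥ 0 and u² ≥ E + F at x = (4n−5)/3.
-- With a = c(A) and b = c(Ā), the hypotheses give v = n − b, v̄ = n − a − 1 and (as n ≥ 3) n ≤ a + b;
-- also a < n, since A has at most n(n − 1) ones. Counting the ones of A in its first a rows against
-- those in its last b columns (which, read backwards, are the zeros of the first b rows of Ā) gives,
-- using only that A has zero diagonal,
--   s + s̄ ≤ ab − (a + b − n)(a + b − 1).
-- After this substitution 9(u² − E − F) at x = (4n−5)/3 is a polynomial with nonnegative coefficients in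
-- the nonnegative quantities n − b, n − a − 1, a + b − n, n − 2 and the slack of the bound on s + s̄.

open import Defs

module FiniteSums where

  open import Data.Nat
  open import Data.Nat.Properties
  open import Function using (_∘_)
  open import Relation.Binary.PropositionalEquality
  open import Relation.Nullary using (yes; no; does)
  open import Relation.Nullary.Decidable using (dec-true; dec-false)
  open import Algebra.Properties.CommutativeSemigroup +-commutativeSemigroup using (interchange)

  ∑ : ℕ → (ℕ → ℕ) → ℕ
  ∑ zero    f = 0
  ∑ (suc k) f = ∑ k f + f k

  syntax ∑ k (λ j → e) = ∑[ j < k ] e

  module _ {f g : ℕ → ℕ} where

    ∑-cong : ∀ k → (∀ {j} → j < k → f j ≡ g j) → ∑ k f ≡ ∑ k g
    ∑-cong zero    _  = refl
    ∑-cong (suc k) eq = cong₂ _+_ (∑-cong k (eq ∘ m<n⇒m<1+n)) (eq (n<1+n k))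

    ∑-mono-≤ : ∀ k → (∀ {j} → j < k → f j ≤ g j) → ∑ k f ≤ ∑ k g
    ∑-mono-≤ zero    _  = z≤n
    ∑-mono-≤ (suc k) le = +-mono-≤ (∑-mono-≤ k (le ∘ m<n⇒m<1+n)) (le (n<1+n k))

    ∑-distrib-+ : ∀ k → ∑[ j < k ] (f j + g j) ≡ ∑ k f + ∑ k g
    ∑-distrib-+ zero    = refl
    ∑-distrib-+ (suc k) = trans (cong (_+ (f k + g k)) (∑-distrib-+ k)) (interchange (∑ k f) (∑ k g) (f k) (g k))

  ∑-monoˡ-≤ : ∀ (f : ℕ → ℕ) {k m} → k ≤ m → ∑ k f ≤ ∑ m f
  ∑-monoˡ-≤ f k≤m with ≤⇒≤′ k≤m
  ... | ≤′-refl       = ≤-refl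
  ... | ≤′-step k≤′m′ = ≤-trans (∑-monoˡ-≤ f (≤′⇒≤ k≤′m′)) (m≤m+n _ _)

  ∑-const : ∀ k c → ∑[ _ < k ] c ≡ k * c
  ∑-const zero    c = refl
  ∑-const (suc k) c = trans (cong (_+ c) (∑-const k c)) (+-comm (k * c) c)

  ∑-zero : ∀ k → ∑[ _ < k ] 0 ≡ 0
  ∑-zero k = trans (∑-const k 0) (*-zeroʳ k)

  ∑-one : ∀ k → ∑[ _ < k ] 1 ≡ k
  ∑-one k = trans (∑-const k 1) (*-identityʳ k)

  ∑-comm : ∀ k m (f : ℕ → ℕ → ℕ) → ∑[ i < k ] ∑[ j < m ] f i j ≡ ∑[ j < m ] ∑[ i < k ] f i j
  ∑-comm zero    m f = sym (∑-zero m)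
  ∑-comm (suc k) m f = trans (cong (_+ ∑[ j < m ] f k j) (∑-comm k m f)) (sym (∑-distrib-+ m))

  ∑-split : ∀ k m (f : ℕ → ℕ) → ∑ (k + m) f ≡ ∑ k f + ∑[ j < m ] f (k + j)
  ∑-split k zero    f = trans (cong (λ l → ∑ l f) (+-identityʳ k)) (sym (+-identityʳ (∑ k f)))
  ∑-split k (suc m) f = begin
    ∑ (k + suc m) f                            ≡⟨ cong (λ l → ∑ l f) (+-suc k m) ⟩
    ∑ (k + m) f + f (k + m)                    ≡⟨ cong (_+ f (k + m)) (∑-split k m f) ⟩
    ∑ k f + ∑[ j < m ] f (k + j) + f (k + m)   ≡⟨ +-assoc (∑ k f) _ _ ⟩
    ∑ k f + ∑[ j < suc m ] f (k + j)           ∎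
    where open ≡-Reasoning

  ∑-reverse : ∀ k (f : ℕ → ℕ) → ∑[ j < k ] f (k ∸ suc j) ≡ ∑ k f
  ∑-reverse zero    f = refl
  ∑-reverse (suc k) f = begin
    ∑[ j < k ] f (k ∸ j) + f (k ∸ k)       ≡⟨ cong₂ _+_ (∑-cong k (cong f ∘ +-∸-assoc 1)) (cong f (n∸n≡0 k)) ⟩
    ∑[ j < k ] f (suc (k ∸ suc j)) + f 0   ≡⟨ cong (_+ f 0) (∑-reverse k (f ∘ suc)) ⟩
    ∑[ j < k ] f (suc j) + f 0             ≡⟨ +-comm _ (f 0) ⟩
    f 0 + ∑[ j < k ] f (suc j)             ≡⟨ ∑-split 1 k f ⟨
    ∑ (suc k) f                            ∎
    where open ≡-Reasoning

  δ : ℕ → ℕ → ℕ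
  δ i j = b2n (does (i ≟ j))

  δ-refl : ∀ i → δ i i ≡ 1
  δ-refl i = cong b2n (dec-true (i ≟ i) refl)

  δ-≢ : ∀ {i j} → i ≢ j → δ i j ≡ 0
  δ-≢ {i} {j} i≢j = cong b2n (dec-false (i ≟ j) i≢j)

  ∑-δ : ∀ {i k} → i < k → ∑[ j < k ] δ i j ≡ 1
  ∑-δ {i} {suc k} i<1+k with i ≟ k
  ... | yes refl = cong₂ _+_ (trans (∑-cong k (δ-≢ ∘ >⇒≢)) (∑-zero k)) (δ-refl k)
  ... | no i≢k   = cong₂ _+_ (∑-δ (≤∧≢⇒< (s≤s⁻¹ i<1+k) i≢k)) (δ-≢ i≢k)

module Counting where

  open import Data.Nat
  open import Data.Nat.Properties
  open import Data.Nat.Tactic.RingSolver using (solve-∀)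
  open import Data.Bool using (true; false; not; T)
  open import Data.Unit using (tt)
  open import Data.Empty using (⊥-elim)
  open import Data.Fin as Fin using (Fin; toℕ; fromℕ<; opposite)
  open import Data.Fin.Properties using (toℕ-fromℕ<; fromℕ<-toℕ; toℕ<n; opposite-prop; toℕ-injective)
  open import Data.List using (map; allFin; tabulate)
  open import Data.List.Properties using (map-tabulate)
  open import Data.Nat.ListAction using (sum)
  open import Data.Sum as Sum using (_⊎_; inj₁; inj₂; [_,_]′)
  open import Function using (_∘_; id)
  open import Relation.Binary.PropositionalEquality
  open import Relation.Nullary using (¬_; yes; no)
  open import Relation.Nullary.Negation using (contradiction)
  open import Algebra.Properties.CommutativeSemigroup +-commutativeSemigroup using (xy∙z≈xz∙y)
  open FiniteSums

  -- Entries are indexed by ℕ, and are 0 outside the matrix, so that prefixes and reversals of rows and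
  -- columns are plain ∑'s.
  entry : ∀ {n} → Mat n → ℕ → ℕ → ℕ
  entry {n} A i j with i <? n | j <? n
  ... | yes i<n | yes j<n = b2n (A (fromℕ< i<n) (fromℕ< j<n))
  ... | _       | _       = 0

  col : ∀ {n} → Mat n → ℕ → ℕ
  col {n} A j = ∑[ i < n ] entry A i j

  b2n≤1 : ∀ b → b2n b ≤ 1
  b2n≤1 true  = ≤-refl
  b2n≤1 false = z≤n

  b2n-not : ∀ b → b2n (not b) + b2n b ≡ 1
  b2n-not true  = refl
  b2n-not false = refl

  on-range : ∀ {n} {P : ℕ → Set} → (∀ (i : Fin n) → P (toℕ i)) → ∀ {i} → i < n → P i
  on-range {P = P} h i<n = subst P (toℕ-fromℕ< i<n) (h (fromℕ< i<n))

  by-range : ∀ {n} {P : ℕ → Set} → (∀ (i : Fin n) → P (toℕ i)) → (∀ {i} → ¬ i < n → P i) → ∀ i → P i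
  by-range {n} inside outside i with i <? n
  ... | yes i<n = on-range inside i<n
  ... | no i≮n  = outside i≮n

  sum-allFin : ∀ {m} (g : Fin m → ℕ) (h : ℕ → ℕ) → (∀ j → g j ≡ h (toℕ j)) → sum (map g (allFin m)) ≡ ∑ m h
  sum-allFin g h g≗h = trans (cong sum (map-tabulate id g)) (sum-tabulate g h g≗h)
    where
    sum-tabulate : ∀ {m} (g : Fin m → ℕ) (h : ℕ → ℕ) → (∀ j → g j ≡ h (toℕ j)) → sum (tabulate g) ≡ ∑ m h
    sum-tabulate {zero}  g h g≗h = refl
    sum-tabulate {suc m} g h g≗h =
      trans (cong₂ _+_ (g≗h Fin.zero) (sum-tabulate (g ∘ Fin.suc) (h ∘ suc) (g≗h ∘ Fin.suc))) (sym (∑-split 1 m h))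

  prefixSum≡∑rowSum : ∀ {n} (A : Mat n) k → prefixSum A k ≡ ∑[ i < k ] rowSum A i
  prefixSum≡∑rowSum A zero    = refl
  prefixSum≡∑rowSum A (suc k) = cong (_+ rowSum A k) (prefixSum≡∑rowSum A k)

  module _ {n : ℕ} (A : Mat n) where

    entry≤1 : ∀ i j → entry A i j ≤ 1
    entry≤1 i j with i <? n | j <? n
    ... | yes _ | yes _ = b2n≤1 _
    ... | yes _ | no  _ = z≤n
    ... | no  _ | _     = z≤n

    entry-toℕ : ∀ (i j : Fin n) → entry A (toℕ i) (toℕ j) ≡ b2n (A i j)
    entry-toℕ i j with toℕ i <? n | toℕ j <? n
    ... | yes i<n | yes j<n = cong₂ (λ i′ j′ → b2n (A i′ j′)) (fromℕ<-toℕ i i<n) (fromℕ<-toℕ j j<n)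
    ... | yes _   | no j≮n  = contradiction (toℕ<n j) j≮n
    ... | no i≮n  | _       = contradiction (toℕ<n i) i≮n

    entry-outside : ∀ {i} → ¬ i < n → ∀ j → entry A i j ≡ 0
    entry-outside {i} i≮n j with i <? n
    ... | yes i<n = contradiction i<n i≮n
    ... | no _    = refl

    rowSum≡∑entry : ∀ i → rowSum A i ≡ ∑[ j < n ] entry A i j
    rowSum≡∑entry i = rowSum≡∑ inside (λ i≮n → entry-outside i≮n)
      where
      inside : ∀ (i<n : i < n) j → b2n (A (fromℕ< i<n) j) ≡ entry A i (toℕ j)
      inside i<n j = sym (trans (cong (λ i → entry A i (toℕ j)) (sym (toℕ-fromℕ< i<n))) (entry-toℕ _ j))

      rowSum≡∑ : ∀ {h : ℕ → ℕ} → (∀ (i<n : i < n) j → b2n (A (fromℕ< i<n) j) ≡ h (toℕ j)) →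
                 (¬ i < n → ∀ j → h j ≡ 0) → rowSum A i ≡ ∑ n h
      rowSum≡∑ {h} inside outside with i <? n
      ... | yes i<n = sum-allFin _ h (inside i<n)
      ... | no i≮n  = sym (trans (∑-cong n (λ _ → outside i≮n _)) (∑-zero n))

  module _ {n : ℕ} (A : Mat n) (zero-diag : ∀ i → A i i ≡ false) where

    entry-diag : ∀ i → entry A i i ≡ 0
    entry-diag = by-range (λ i → trans (entry-toℕ A i i) (cong b2n (zero-diag i))) (λ i≮n → entry-outside A i≮n _)

    entry+δ≤1 : ∀ p q → entry A p q + δ q p ≤ 1
    entry+δ≤1 p q with q ≟ p
    ... | yes refl = ≤-reflexive (cong₂ _+_ (entry-diag q) (δ-refl q))
    ... | no q≢p   = ≤-trans (≤-reflexive (trans (cong (entry A p q +_) (δ-≢ q≢p)) (+-identityʳ _))) (entry≤1 A p q)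

    col-prefix-bound : ∀ {q c} → q < c → ∑[ p < c ] entry A p q + 1 ≤ c
    col-prefix-bound {q} {c} q<c = begin
      ∑[ p < c ] entry A p q + 1                  ≡⟨ cong (∑[ p < c ] entry A p q +_) (∑-δ q<c) ⟨
      ∑[ p < c ] entry A p q + ∑[ p < c ] δ q p   ≡⟨ ∑-distrib-+ c ⟨
      ∑[ p < c ] (entry A p q + δ q p)            ≤⟨ ∑-mono-≤ c (λ {p} _ → entry+δ≤1 p q) ⟩
      ∑[ p < c ] 1                                ≡⟨ ∑-one c ⟩
      c                                           ∎
      where open ≤-Reasoning

    bar-entry-Fin : ∀ (i j : Fin n) → b2n (bar A i j) + b2n (A (opposite j) (opposite i)) + δ (toℕ i) (toℕ j) ≡ 1
    bar-entry-Fin i j with i Fin.≟ j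
    ... | yes refl = cong₂ _+_ (cong b2n (zero-diag (opposite i))) (δ-refl (toℕ i))
    ... | no i≢j   = cong₂ _+_ (b2n-not (A (opposite j) (opposite i))) (δ-≢ (i≢j ∘ toℕ-injective))

    bar-entry : ∀ {i j} → i < n → j < n → entry (bar A) i j + entry A (n ∸ suc j) (n ∸ suc i) + δ i j ≡ 1
    bar-entry i<n j<n = on-range {P = λ i → ∀ {j} → j < n → _} (λ i → on-range (λ j → begin
      entry (bar A) (toℕ i) (toℕ j) + entry A (n ∸ suc (toℕ j)) (n ∸ suc (toℕ i)) + δ (toℕ i) (toℕ j)
        ≡⟨ cong₂ (λ j′ i′ → entry (bar A) (toℕ i) (toℕ j) + entry A j′ i′ + δ (toℕ i) (toℕ j)) (opposite-prop j) (opposite-prop i) ⟨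
      entry (bar A) (toℕ i) (toℕ j) + entry A (toℕ (opposite j)) (toℕ (opposite i)) + δ (toℕ i) (toℕ j)
        ≡⟨ cong₂ (λ x y → x + y + δ (toℕ i) (toℕ j)) (entry-toℕ (bar A) i j) (entry-toℕ A (opposite j) (opposite i)) ⟩
      b2n (bar A i j) + b2n (A (opposite j) (opposite i)) + δ (toℕ i) (toℕ j)
        ≡⟨ bar-entry-Fin i j ⟩
      1 ∎)) i<n j<n
      where open ≡-Reasoning

    rowSum-bar : ∀ {i} → i < n → rowSum (bar A) i + col A (n ∸ suc i) + 1 ≡ n
    rowSum-bar {i} i<n = begin
      rowSum (bar A) i + col A (n ∸ suc i) + 1
        ≡⟨ cong₂ _+_ (cong₂ _+_ (rowSum≡∑entry (bar A) i) (sym (∑-reverse n (λ p → entry A p (n ∸ suc i))))) (sym (∑-δ i<n)) ⟩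
      ∑[ j < n ] ē j + ∑[ j < n ] e j + ∑[ j < n ] δ i j   ≡⟨ cong (_+ ∑[ j < n ] δ i j) (∑-distrib-+ n) ⟨
      ∑[ j < n ] (ē j + e j) + ∑[ j < n ] δ i j            ≡⟨ ∑-distrib-+ n ⟨
      ∑[ j < n ] (ē j + e j + δ i j)                       ≡⟨ ∑-cong n (bar-entry i<n) ⟩
      ∑[ j < n ] 1                                         ≡⟨ ∑-one n ⟩
      n                                                    ∎
      where
      open ≡-Reasoning
      ē e : ℕ → ℕ
      ē j = entry (bar A) i j
      e j = entry A (n ∸ suc j) (n ∸ suc i)

    block-bound : ∀ {k a} → k ≤ a → ∑[ i < a ] ∑[ j < k ] entry A i j + k ≤ k * a
    block-bound {k} {a} k≤a = begin
      ∑[ i < a ] ∑[ j < k ] entry A i j + k              ≡⟨ cong (_+ k) (∑-comm a k _) ⟩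
      ∑[ j < k ] ∑[ i < a ] entry A i j + k              ≡⟨ cong (∑[ j < k ] ∑[ i < a ] entry A i j +_) (∑-one k) ⟨
      ∑[ j < k ] ∑[ i < a ] entry A i j + ∑[ j < k ] 1   ≡⟨ ∑-distrib-+ k ⟨
      ∑[ j < k ] (∑[ i < a ] entry A i j + 1)            ≤⟨ ∑-mono-≤ k (λ j<k → col-prefix-bound (<-≤-trans j<k k≤a)) ⟩
      ∑[ j < k ] a                                       ≡⟨ ∑-const k a ⟩
      k * a                                              ∎
      where open ≤-Reasoning

    prefixSum-bound : ∀ {k b a} → k + b ≡ n → k ≤ a → a ≤ n →
                      prefixSum A a + k ≤ k * a + ∑[ t < b ] col A (k + t)
    prefixSum-bound {k} {b} {a} k+b≡n k≤a a≤n = begin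
      prefixSum A a + k
        ≡⟨ cong (_+ k) (trans (prefixSum≡∑rowSum A a) (∑-cong a (λ {i} _ → trans (rowSum≡∑entry A i) (split i)))) ⟩
      ∑[ i < a ] (left i + right i) + k         ≡⟨ cong (_+ k) (∑-distrib-+ a) ⟩
      ∑[ i < a ] left i + ∑[ i < a ] right i + k  ≡⟨ xy∙z≈xz∙y (∑[ i < a ] left i) (∑[ i < a ] right i) k ⟩
      ∑[ i < a ] left i + k + ∑[ i < a ] right i  ≤⟨ +-mono-≤ (block-bound k≤a) (∑-monoˡ-≤ right a≤n) ⟩
      k * a + ∑[ i < n ] right i                ≡⟨ cong (k * a +_) (∑-comm n b _) ⟩
      k * a + ∑[ t < b ] col A (k + t)          ∎
      where
      open ≤-Reasoning
      left right : ℕ → ℕ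
      left i = ∑[ j < k ] entry A i j
      right i = ∑[ t < b ] entry A i (k + t)
      split : ∀ i → ∑[ j < n ] entry A i j ≡ left i + right i
      split i = trans (cong (λ m → ∑ m (entry A i)) (sym k+b≡n)) (∑-split k b (entry A i))

    prefixSum-bar : ∀ {k b} → k + b ≡ n → prefixSum (bar A) b + ∑[ t < b ] col A (k + t) + b ≡ b * n
    prefixSum-bar {k} {b} k+b≡n = begin
      prefixSum (bar A) b + ∑[ t < b ] col A (k + t) + b
        ≡⟨ cong₂ (λ x y → x + y + b) (prefixSum≡∑rowSum (bar A) b) (sym (∑-reverse b (λ t → col A (k + t)))) ⟩
      ∑[ i < b ] rowSum (bar A) i + ∑[ i < b ] col A (k + (b ∸ suc i)) + b
        ≡⟨ cong₂ _+_ (∑-distrib-+ b) (∑-one b) ⟨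
      ∑[ i < b ] (rowSum (bar A) i + col A (k + (b ∸ suc i))) + ∑[ i < b ] 1
        ≡⟨ ∑-distrib-+ b ⟨
      ∑[ i < b ] (rowSum (bar A) i + col A (k + (b ∸ suc i)) + 1)
        ≡⟨ ∑-cong b (λ {i} i<b → trans (cong (λ j → rowSum (bar A) i + col A j + 1) (reindex i<b)) (rowSum-bar (<-≤-trans i<b b≤n))) ⟩
      ∑[ i < b ] n
        ≡⟨ ∑-const b n ⟩
      b * n ∎
      where
      open ≡-Reasoning
      b≤n : b ≤ n
      b≤n = subst (b ≤_) k+b≡n (m≤n+m b k)
      reindex : ∀ {i} → i < b → k + (b ∸ suc i) ≡ n ∸ suc i
      reindex {i} i<b = trans (sym (+-∸-assoc k i<b)) (cong (_∸ suc i) k+b≡n)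

    prefixSum-count : ∀ {a b} → a ≤ n → b ≤ n → n ≤ a + b →
                      prefixSum A a + prefixSum (bar A) b + n + a * b ≤ (a + b) * n
    prefixSum-count {a} {b} a≤n b≤n n≤a+b =
      combine k+b≡n (prefixSum-bound {b = b} k+b≡n k≤a a≤n) (prefixSum-bar {n ∸ b} k+b≡n)
      where
      k+b≡n : n ∸ b + b ≡ n
      k+b≡n = m∸n+n≡m b≤n
      k≤a : n ∸ b ≤ a
      k≤a = m≤n+o⇒m∸n≤o n b (subst (n ≤_) (+-comm a b) n≤a+b)
      combine : ∀ {P P̄ Y k} → k + b ≡ n → P + k ≤ k * a + Y → P̄ + Y + b ≡ b * n → P + P̄ + n + a * b ≤ (a + b) * n
      combine {P} {P̄} {Y} {k} refl P-bound P̄-eq = +-cancelʳ-≤ Y _ _ (begin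
        P + P̄ + (k + b) + a * b + Y          ≡⟨ regroup P P̄ Y k a b ⟩
        (P + k) + (P̄ + Y + b) + b * a         ≤⟨ +-monoˡ-≤ (b * a) (+-mono-≤ P-bound (≤-reflexive P̄-eq)) ⟩
        (k * a + Y) + b * (k + b) + b * a     ≡⟨ expand Y k a b ⟩
        (a + b) * (k + b) + Y                 ∎)
        where
        open ≤-Reasoning
        regroup : ∀ P P̄ Y k a b → P + P̄ + (k + b) + a * b + Y ≡ (P + k) + (P̄ + Y + b) + b * a
        regroup = solve-∀
        expand : ∀ Y k a b → (k * a + Y) + b * (k + b) + b * a ≡ (a + b) * (k + b) + Y
        expand = solve-∀

  maxSat-≤ : ∀ p k → maxSat p k ≤ k
  maxSat-≤ p zero    = z≤n
  maxSat-≤ p (suc k) with p (suc k)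
  ... | true  = ≤-refl
  ... | false = m≤n⇒m≤1+n (maxSat-≤ p k)

  maxSat-sound : ∀ p k → maxSat p k ≡ 0 ⊎ T (p (maxSat p k))
  maxSat-sound p zero    = inj₁ refl
  maxSat-sound p (suc k) with p (suc k) in eq
  ... | true  = inj₂ (subst T (sym eq) tt)
  ... | false = maxSat-sound p k

  n*[n∸1]+n≡n*n : ∀ n → n * (n ∸ 1) + n ≡ n * n
  n*[n∸1]+n≡n*n zero    = refl
  n*[n∸1]+n≡n*n (suc m) = trans (+-comm (suc m * m) (suc m)) (sym (*-suc (suc m) m))

  module _ {n : ℕ} (A : Mat n) where

    cA≤n : cA A ≤ n
    cA≤n = maxSat-≤ _ n

    cA-sound : cA A ≡ 0 ⊎ cA A * (cA A ∸ 1) < prefixSum A (cA A)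
    cA-sound = Sum.map₂ (<ᵇ⇒< _ _) (maxSat-sound _ n)

    -- The subtraction defining sA A does not truncate; this form of its definition avoids ∸.
    sA-spec : sA A + cA A * cA A ≡ prefixSum A (cA A) + cA A
    sA-spec = begin
      sA A + c * c              ≡⟨ cong (sA A +_) (n*[n∸1]+n≡n*n c) ⟨
      sA A + (c * (c ∸ 1) + c)  ≡⟨ +-assoc (sA A) _ c ⟨
      sA A + c * (c ∸ 1) + c    ≡⟨ cong (_+ c) (m∸n+n≡m below) ⟩
      prefixSum A c + c         ∎
      where
      open ≡-Reasoning
      c : ℕ
      c = cA A
      below : c * (c ∸ 1) ≤ prefixSum A c
      below = [ (λ c≡0 → ≤-trans (≤-reflexive (cong (λ c → c * (c ∸ 1)) c≡0)) z≤n) , <⇒≤ ]′ cA-sound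

  module _ {n : ℕ} (A : Mat n) (zero-diag : ∀ i → A i i ≡ false) where

    cA<n : 1 ≤ n → cA A < n
    cA<n 1≤n with m≤n⇒m<n∨m≡n (cA≤n A) | cA-sound A
    ... | inj₁ c<n | _        = c<n
    ... | inj₂ c≡n | inj₁ c≡0 = contradiction (subst (1 ≤_) (trans (sym c≡n) c≡0) 1≤n) λ ()
    ... | inj₂ c≡n | inj₂ c-strict = ⊥-elim (<-irrefl refl (begin-strict
      n * (n ∸ 1) + n     <⟨ +-monoˡ-< n (subst (λ c → c * (c ∸ 1) < prefixSum A c) c≡n c-strict) ⟩
      prefixSum A n + n   ≤⟨ all-rows ⟩
      n * n               ≡⟨ n*[n∸1]+n≡n*n n ⟨
      n * (n ∸ 1) + n     ∎))
      where
      open ≤-Reasoning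
      drop-zeros : ∀ P n → P + 0 + n + n * 0 ≡ P + n
      drop-zeros = solve-∀
      all-rows : prefixSum A n + n ≤ n * n
      all-rows = subst₂ _≤_ (drop-zeros (prefixSum A n) n) (cong (_* n) (+-identityʳ n))
                   (prefixSum-count A zero-diag ≤-refl z≤n (m≤m+n n 0))

    -- s + s̄ ≤ ab − (a + b − n)(a + b − 1), with both sides moved so that no subtraction occurs.
    s+s̄-bound : n ≤ cA A + cA (bar A) →
                sA A + sA (bar A) + cA A * cA A + cA (bar A) * cA (bar A) + n + cA A * cA (bar A)
                  ≤ (cA A + cA (bar A)) * n + cA A + cA (bar A)
    s+s̄-bound n≤a+b = begin
      s + s̄ + a * a + b * b + n + a * b       ≡⟨ regroup s s̄ (a * a) (b * b) n (a * b) ⟩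
      (s + a * a) + (s̄ + b * b) + n + a * b   ≡⟨ cong₂ (λ x y → x + y + n + a * b) (sA-spec A) (sA-spec (bar A)) ⟩
      (P + a) + (P̄ + b) + n + a * b           ≡⟨ regroup′ P P̄ a b n (a * b) ⟩
      P + P̄ + n + a * b + a + b               ≤⟨ +-monoˡ-≤ b (+-monoˡ-≤ a (prefixSum-count A zero-diag (cA≤n A) (cA≤n (bar A)) n≤a+b)) ⟩
      (a + b) * n + a + b                     ∎
      where
      open ≤-Reasoning
      a b s s̄ P P̄ : ℕ
      a = cA A
      b = cA (bar A)
      s = sA A
      s̄ = sA (bar A)
      P = prefixSum A a
      P̄ = prefixSum (bar A) b
      regroup : ∀ s s̄ x y n z → s + s̄ + x + y + n + z ≡ (s + x) + (s̄ + y) + n + z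
      regroup = solve-∀
      regroup′ : ∀ P P̄ a b n z → (P + a) + (P̄ + b) + n + z ≡ P + P̄ + n + z + a + b
      regroup′ = solve-∀

module Rational where

  open import Data.Nat as ℕ using (ℕ)
  import Data.Nat.Properties as ℕP
  open import Data.Nat.Tactic.RingSolver using (solve-∀)
  open import Data.Integer as ℤ using (ℤ; +_)
  import Data.Integer.Properties as ℤP
  import Data.Integer.Tactic.RingSolver as ℤ-Solver
  open import Data.Nat.Coprimality using (1-coprimeTo) renaming (sym to coprime-sym)
  open import Data.Product using (_×_; _,_; proj₁; proj₂)
  open import Data.Rational using (ℚ; mkℚ; _/_; _≤_; _<_; 0ℚ; _+_; _*_; _-_; -_; nonNegative; positive)
  open import Data.Rational.Properties
    using (≤-trans; +-identityʳ; +-inverseʳ; +-mono-≤; +-monoˡ-≤; +-monoʳ-≤; +-mono-<-≤; +-monoˡ-<; +-monoʳ-<;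
           nonNegative⁻¹; positive⁻¹; normalize-nonNeg; nonNeg*nonNeg⇒nonNeg; pos*pos⇒pos;
           *-monoˡ-≤-nonNeg; *-monoʳ-≤-nonNeg; *-cancelˡ-≤-pos; *-zeroʳ; ↥p/↧p≡p; drop-*≤*;
           toℚᵘ-injective; toℚᵘ-homo-*; toℚᵘ-fromℚᵘ; module ≤-Reasoning)
  open import Data.Rational.Unnormalised using (mkℚᵘ; *≡*)
  open import Data.Rational.Unnormalised.Properties using (≃-trans; ≃-sym; *-congˡ)
  open import Data.Rational.Solver using (module +-*-Solver)
  open +-*-Solver using (solve; _:+_; _:*_; _:-_; _:=_; con)
  open import Relation.Binary.PropositionalEquality

  p≤p+r : ∀ {p r} → 0ℚ ≤ r → p ≤ p + r
  p≤p+r {p} 0≤r = subst (_≤ p + _) (+-identityʳ p) (+-monoʳ-≤ p 0≤r)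

  p<p+r : ∀ {p r} → 0ℚ < r → p < p + r
  p<p+r {p} 0<r = subst (_< p + _) (+-identityʳ p) (+-monoʳ-< p 0<r)

  p≤r⇒0≤r-p : ∀ {p r} → p ≤ r → 0ℚ ≤ r - p
  p≤r⇒0≤r-p {p} {r} p≤r = subst (_≤ r - p) (+-inverseʳ p) (+-monoˡ-≤ (- p) p≤r)

  p<r⇒0<r-p : ∀ {p r} → p < r → 0ℚ < r - p
  p<r⇒0<r-p {p} {r} p<r = subst (_< r - p) (+-inverseʳ p) (+-monoˡ-< (- p) p<r)

  0≤+ : ∀ {p r} → 0ℚ ≤ p → 0ℚ ≤ r → 0ℚ ≤ p + r
  0≤+ = +-mono-≤

  0<+ : ∀ {p r} → 0ℚ < p → 0ℚ ≤ r → 0ℚ < p + r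
  0<+ = +-mono-<-≤

  0≤* : ∀ {p r} → 0ℚ ≤ p → 0ℚ ≤ r → 0ℚ ≤ p * r
  0≤* {p} {r} 0≤p 0≤r = nonNegative⁻¹ _ {{nonNeg*nonNeg⇒nonNeg p {{nonNegative 0≤p}} r {{nonNegative 0≤r}}}}

  0<* : ∀ {p r} → 0ℚ < p → 0ℚ < r → 0ℚ < p * r
  0<* {p} {r} 0<p 0<r = positive⁻¹ _ {{pos*pos⇒pos p {{positive 0<p}} r {{positive 0<r}}}}

  *-self-mono-≤ : ∀ {p r} → 0ℚ ≤ p → p ≤ r → p * p ≤ r * r
  *-self-mono-≤ {p} {r} 0≤p p≤r = ≤-trans (*-monoˡ-≤-nonNeg p {{nonNegative 0≤p}} p≤r)
                                           (*-monoʳ-≤-nonNeg r {{nonNegative (≤-trans 0≤p p≤r)}} p≤r)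

  /1≡mkℚ : ∀ i → i / 1 ≡ mkℚ i 0 (coprime-sym (1-coprimeTo ℤ.∣ i ∣))
  /1≡mkℚ i = ↥p/↧p≡p (mkℚ i 0 _)

  /1-+ : ∀ i j → (i ℤ.+ j) / 1 ≡ i / 1 + j / 1
  /1-+ i j rewrite /1≡mkℚ i | /1≡mkℚ j = cong (_/ 1) (sym (cong₂ ℤ._+_ (ℤP.*-identityʳ i) (ℤP.*-identityʳ j)))

  /1-* : ∀ i j → (i ℤ.* j) / 1 ≡ (i / 1) * (j / 1)
  /1-* i j rewrite /1≡mkℚ i | /1≡mkℚ j = refl

  q-+ : ∀ m k → q (m ℕ.+ k) ≡ q m + q k
  q-+ m k = /1-+ (+ m) (+ k)

  q-* : ∀ m k → q (m ℕ.* k) ≡ q m * q k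
  q-* m k = trans (cong (_/ 1) (ℤP.pos-* m k)) (/1-* (+ m) (+ k))

  0≤q : ∀ m → 0ℚ ≤ q m
  0≤q m = nonNegative⁻¹ (q m) {{normalize-nonNeg m 1}}

  q-mono-≤ : ∀ {m k} → m ℕ.≤ k → q m ≤ q k
  q-mono-≤ {m} {k} m≤k = subst (q m ≤_) (trans (sym (q-+ m (k ℕ.∸ m))) (cong q (ℕP.m+[n∸m]≡n m≤k))) (p≤p+r (0≤q (k ℕ.∸ m)))

  q-cancel-≤ : ∀ {m k} → q m ≤ q k → m ℕ.≤ k
  q-cancel-≤ {m} {k} le rewrite /1≡mkℚ (+ m) | /1≡mkℚ (+ k) =
    ℤP.drop‿+≤+ (subst₂ ℤ._≤_ (ℤP.*-identityʳ (+ m)) (ℤP.*-identityʳ (+ k)) (drop-*≤* le))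

  q-∸ : ∀ {m k} → k ℕ.≤ m → q (m ℕ.∸ k) ≡ q m - q k
  q-∸ {m} {k} k≤m = begin
    q (m ℕ.∸ k)                ≡⟨ solve 2 (λ p r → p := p :+ r :- r) refl (q (m ℕ.∸ k)) (q k) ⟩
    q (m ℕ.∸ k) + q k - q k    ≡⟨ cong (_- q k) (trans (sym (q-+ (m ℕ.∸ k) k)) (cong q (ℕP.m∸n+n≡m k≤m))) ⟩
    q m - q k                  ∎
    where open ≡-Reasoning

  infixl 6 _⊕_
  infixl 7 _⊗_
  data Poly : Set where
    ‵_      : ℕ → Poly
    _⊕_ _⊗_ : Poly → Poly → Poly

  ⟦_⟧ℕ : Poly → ℕ
  ⟦ ‵ m   ⟧ℕ = m
  ⟦ e ⊕ f ⟧ℕ = ⟦ e ⟧ℕ ℕ.+ ⟦ f ⟧ℕ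
  ⟦ e ⊗ f ⟧ℕ = ⟦ e ⟧ℕ ℕ.* ⟦ f ⟧ℕ

  ⟦_⟧ℚ : Poly → ℚ
  ⟦ ‵ m   ⟧ℚ = q m
  ⟦ e ⊕ f ⟧ℚ = ⟦ e ⟧ℚ + ⟦ f ⟧ℚ
  ⟦ e ⊗ f ⟧ℚ = ⟦ e ⟧ℚ * ⟦ f ⟧ℚ

  q-⟦⟧ : ∀ e → q ⟦ e ⟧ℕ ≡ ⟦ e ⟧ℚ
  q-⟦⟧ (‵ m)   = refl
  q-⟦⟧ (e ⊕ f) = trans (q-+ ⟦ e ⟧ℕ ⟦ f ⟧ℕ) (cong₂ _+_ (q-⟦⟧ e) (q-⟦⟧ f))
  q-⟦⟧ (e ⊗ f) = trans (q-* ⟦ e ⟧ℕ ⟦ f ⟧ℕ) (cong₂ _*_ (q-⟦⟧ e) (q-⟦⟧ f))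

  ⟦⟧-mono-≤ : ∀ e f → ⟦ e ⟧ℕ ℕ.≤ ⟦ f ⟧ℕ → ⟦ e ⟧ℚ ≤ ⟦ f ⟧ℚ
  ⟦⟧-mono-≤ e f le = subst₂ _≤_ (q-⟦⟧ e) (q-⟦⟧ f) (q-mono-≤ le)

  3*lowerBound+5≡4n : ∀ n → q 3 * lowerBound n + q 5 ≡ q (4 ℕ.* n)
  3*lowerBound+5≡4n n = begin
    q 3 * (i / 3) + q 5    ≡⟨ cong (_+ q 5) cancel-3 ⟩
    i / 1 + q 5            ≡⟨ /1-+ i (+ 5) ⟨
    (i ℤ.+ + 5) / 1        ≡⟨ cong (_/ 1) (cancel-5 (+ (4 ℕ.* n))) ⟩
    q (4 ℕ.* n)            ∎
    where
    open ≡-Reasoning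
    i : ℤ
    i = + (4 ℕ.* n) ℤ.- + 5
    cancel-5 : ∀ m → m ℤ.- + 5 ℤ.+ + 5 ≡ m
    cancel-5 = ℤ-Solver.solve-∀
    cancel-3 : q 3 * (i / 3) ≡ i / 1
    cancel-3 = toℚᵘ-injective (≃-trans (toℚᵘ-homo-* (q 3) (i / 3))
                 (≃-trans (*-congˡ {mkℚᵘ (+ 3) 0} (toℚᵘ-fromℚᵘ (mkℚᵘ i 2)))
                   (≃-trans (*≡* (trans (ℤP.*-identityʳ _) (ℤP.*-comm (+ 3) i))) (≃-sym (toℚᵘ-fromℚᵘ (mkℚᵘ i 0))))))

  lowerBound≤⇒≤ : ∀ {n m} → 3 ℕ.≤ n → lowerBound n ≤ q m → n ℕ.≤ m
  lowerBound≤⇒≤ {n} {m} 3≤n L≤m = ℕP.≮⇒≥ λ m<n →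
    ℕP.<-irrefl refl (ℕP.≤-trans (subst₂ ℕ._≤_ (shift m) (4* n) (ℕP.+-mono-≤ (ℕP.*-monoʳ-≤ 3 m<n) 3≤n)) 4n≤3m+5)
    where
    4n≤3m+5 : 4 ℕ.* n ℕ.≤ 3 ℕ.* m ℕ.+ 5
    4n≤3m+5 = q-cancel-≤ (subst₂ _≤_ (3*lowerBound+5≡4n n) (sym (q-⟦⟧ (‵ 3 ⊗ ‵ m ⊕ ‵ 5)))
                            (+-monoˡ-≤ (q 5) (*-monoˡ-≤-nonNeg (q 3) L≤m)))
    shift : ∀ m → 3 ℕ.* ℕ.suc m ℕ.+ 3 ≡ ℕ.suc (3 ℕ.* m ℕ.+ 5)
    shift = solve-∀
    4* : ∀ n → 3 ℕ.* n ℕ.+ n ≡ 4 ℕ.* n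
    4* = solve-∀

  quartic : ℚ → ℚ → ℚ → ℚ
  quartic P d y = (y * y) * (y * y - q 2 * P) + d * d

  quartic-increasing : ∀ {P d y y′} → P ≤ y * y → 0ℚ ≤ y → y < y′ → quartic P d y < quartic P d y′
  quartic-increasing {P} {d} {y} {y′} P≤y² 0≤y y<y′ = begin-strict
    quartic P d y                        <⟨ p<p+r (0<* 0<β (0<+ 0<β (0≤* (0≤q 2) (p≤r⇒0≤r-p P≤y²)))) ⟩
    quartic P d y + β * (β + q 2 * α)    ≡⟨ solve 4 (λ P d y y′ →
        let β = y′ :* y′ :- y :* y
            g = λ y → (y :* y) :* (y :* y :- con (q 2) :* P) :+ d :* d
        in g y :+ β :* (β :+ con (q 2) :* (y :* y :- P)) := g y′) refl P d y y′ ⟩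
    quartic P d y′                       ∎
    where
    open ≤-Reasoning
    α β : ℚ
    α = y * y - P
    β = y′ * y′ - y * y
    0<δ : 0ℚ < y′ - y
    0<δ = p<r⇒0<r-p y<y′
    0<β : 0ℚ < β
    0<β = subst (0ℚ <_) (solve 2 (λ y y′ → (y′ :- y) :* ((y′ :- y) :+ con (q 2) :* y) := y′ :* y′ :- y :* y) refl y y′)
                        (0<* 0<δ (0<+ 0<δ (0≤* (0≤q 2) 0≤y)))

  u : ℕ → ℕ → ℚ → ℚ
  u v v̄ x = q 2 * x - q v - q v̄ + q 2

  gfun≡quartic : ∀ v v̄ E F x → gfun v v̄ E F x ≡ quartic (E + F) (E - F) (u v v̄ x)
  gfun≡quartic v v̄ E F x = refl

  u-step : ∀ v v̄ x y → u v v̄ y ≡ u v v̄ x + q 2 * (y - x)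
  u-step v v̄ x y = solve 4 (λ V V̄ x y → con (q 2) :* y :- V :- V̄ :+ con (q 2)
                              := con (q 2) :* x :- V :- V̄ :+ con (q 2) :+ con (q 2) :* (y :- x)) refl (q v) (q v̄) x y

  u-mono-≤ : ∀ {v v̄ x y} → x ≤ y → u v v̄ x ≤ u v v̄ y
  u-mono-≤ {v} {v̄} {x} {y} x≤y = subst (u v v̄ x ≤_) (sym (u-step v v̄ x y)) (p≤p+r (0≤* (0≤q 2) (p≤r⇒0≤r-p x≤y)))

  u-mono-< : ∀ {v v̄ x y} → x < y → u v v̄ x < u v v̄ y
  u-mono-< {v} {v̄} {x} {y} x<y = subst (u v v̄ x <_) (sym (u-step v v̄ x y)) (p<p+r (0<* (positive⁻¹ (q 2)) (p<r⇒0<r-p x<y)))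

  3*u[L]≡2n-1+3[a+b] : ∀ {L n a b v v̄ : ℚ} → q 3 * L + q 5 ≡ q 4 * n → v ≡ n - b → v̄ ≡ n - (a + q 1) →
         q 3 * (q 2 * L - v - v̄ + q 2) ≡ q 2 * n - q 1 + q 3 * (a + b)
  3*u[L]≡2n-1+3[a+b] {L} {n} {a} {b} 3L+5≡4n refl refl = begin
    q 3 * (q 2 * L - (n - b) - (n - (a + q 1)) + q 2)       ≡⟨ solve 4 (λ L n a b →
        con (q 3) :* (con (q 2) :* L :- (n :- b) :- (n :- (a :+ con (q 1))) :+ con (q 2))
        := con (q 2) :* (con (q 3) :* L :+ con (q 5)) :- con (q 6) :* n :- con (q 1) :+ con (q 3) :* (a :+ b)) refl L n a b ⟩
    q 2 * (q 3 * L + q 5) - q 6 * n - q 1 + q 3 * (a + b)   ≡⟨ cong (λ t → q 2 * t - q 6 * n - q 1 + q 3 * (a + b)) 3L+5≡4n ⟩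
    q 2 * (q 4 * n) - q 6 * n - q 1 + q 3 * (a + b)         ≡⟨ solve 3 (λ n a b →
        con (q 2) :* (con (q 4) :* n) :- con (q 6) :* n :- con (q 1) :+ con (q 3) :* (a :+ b)
        := con (q 2) :* n :- con (q 1) :+ con (q 3) :* (a :+ b)) refl n a b ⟩
    q 2 * n - q 1 + q 3 * (a + b)                           ∎
    where open ≡-Reasoning

  -- EF c v s unfolds to Eℚ (q c) (q v) (q s).
  Eℚ : ℚ → ℚ → ℚ → ℚ
  Eℚ c v s = (q 2 * c - v - q 1) * (q 2 * c - v - q 1) + q 4 * s

  E+F≤U² : ∀ {a b n s s̄ v v̄ U : ℚ} → v ≡ n - b → v̄ ≡ n - (a + q 1) →
           b ≤ n → a + q 1 ≤ n → n ≤ a + b → q 2 ≤ n →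
           s + s̄ + a * a + b * b + n + a * b ≤ (a + b) * n + a + b →
           q 3 * U ≡ q 2 * n - q 1 + q 3 * (a + b) →
           0ℚ ≤ U × Eℚ a v s + Eℚ b v̄ s̄ ≤ U * U
  E+F≤U² {a} {b} {n} {s} {s̄} {U = U} refl refl b≤n a+1≤n n≤a+b 2≤n budget 3U≡w = 0≤U , E+F≤U*U
    where
    v v̄ x k d w E F Δ : ℚ
    v = n - b
    v̄ = n - (a + q 1)
    x = a + b - n
    k = n - q 2
    d = (a + b) * n + a + b - (s + s̄ + a * a + b * b + n + a * b)
    w = q 2 * n - q 1 + q 3 * (a + b)
    E = Eℚ a v s
    F = Eℚ b v̄ s̄
    Δ = q 16 * (v * v) + q 16 * (v̄ * v̄) + q 28 * (x * x) + q 14 * (v * v̄) + q 44 * (v * x) + q 44 * (v̄ * x)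
        + q 6 * x + q 22 * k + q 20 + q 36 * d

    certificate : w * w ≡ q 9 * (E + F) + Δ
    certificate = solve 5 (λ a b n s s̄ →
      let v = n :- b
          v̄ = n :- (a :+ con (q 1))
          x = a :+ b :- n
          k = n :- con (q 2)
          d = (a :+ b) :* n :+ a :+ b :- (s :+ s̄ :+ a :* a :+ b :* b :+ n :+ a :* b)
          e = λ c v s → (con (q 2) :* c :- v :- con (q 1)) :* (con (q 2) :* c :- v :- con (q 1)) :+ con (q 4) :* s
          w = con (q 2) :* n :- con (q 1) :+ con (q 3) :* (a :+ b)
      in w :* w := con (q 9) :* (e a v s :+ e b v̄ s̄)
                   :+ (con (q 16) :* (v :* v) :+ con (q 16) :* (v̄ :* v̄) :+ con (q 28) :* (x :* x)
                       :+ con (q 14) :* (v :* v̄) :+ con (q 44) :* (v :* x) :+ con (q 44) :* (v̄ :* x)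
                       :+ con (q 6) :* x :+ con (q 22) :* k :+ con (q 20) :+ con (q 36) :* d))
      refl a b n s s̄

    w≡ : w ≡ q 5 * k + q 3 * x + q 9
    w≡ = solve 3 (λ a b n → con (q 2) :* n :- con (q 1) :+ con (q 3) :* (a :+ b)
                         := con (q 5) :* (n :- con (q 2)) :+ con (q 3) :* (a :+ b :- n) :+ con (q 9)) refl a b n

    0≤v : 0ℚ ≤ v
    0≤v = p≤r⇒0≤r-p b≤n
    0≤v̄ : 0ℚ ≤ v̄
    0≤v̄ = p≤r⇒0≤r-p a+1≤n
    0≤x : 0ℚ ≤ x
    0≤x = p≤r⇒0≤r-p n≤a+b
    0≤k : 0ℚ ≤ k
    0≤k = p≤r⇒0≤r-p 2≤n
    0≤d : 0ℚ ≤ d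
    0≤d = p≤r⇒0≤r-p budget

    _·_ : ∀ m {p} → 0ℚ ≤ p → 0ℚ ≤ q m * p
    m · 0≤p = 0≤* (0≤q m) 0≤p

    0≤Δ : 0ℚ ≤ Δ
    0≤Δ = 0≤+ (0≤+ (0≤+ (0≤+ (0≤+ (0≤+ (0≤+ (0≤+ (0≤+
            (16 · 0≤* 0≤v 0≤v) (16 · 0≤* 0≤v̄ 0≤v̄)) (28 · 0≤* 0≤x 0≤x)) (14 · 0≤* 0≤v 0≤v̄))
            (44 · 0≤* 0≤v 0≤x)) (44 · 0≤* 0≤v̄ 0≤x)) (6 · 0≤x)) (22 · 0≤k)) (0≤q 20)) (36 · 0≤d)

    0≤U : 0ℚ ≤ U
    0≤U = *-cancelˡ-≤-pos (q 3) (subst₂ _≤_ (sym (*-zeroʳ (q 3))) (sym 3U≡w)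
            (subst (0ℚ ≤_) (sym w≡) (0≤+ (0≤+ (5 · 0≤k) (3 · 0≤x)) (0≤q 9))))

    E+F≤U*U : E + F ≤ U * U
    E+F≤U*U = *-cancelˡ-≤-pos (q 9) (begin
      q 9 * (E + F)          ≤⟨ p≤p+r 0≤Δ ⟩
      q 9 * (E + F) + Δ      ≡⟨ certificate ⟨
      w * w                  ≡⟨ cong₂ _*_ 3U≡w 3U≡w ⟨
      (q 3 * U) * (q 3 * U)  ≡⟨ solve 1 (λ U → (con (q 3) :* U) :* (con (q 3) :* U) := con (q 9) :* (U :* U)) refl U ⟩
      q 9 * (U * U)          ∎)
      where open ≤-Reasoning

  gfun-increasing : ∀ {n a b s s̄ v v̄ : ℕ} → 2 ℕ.≤ n → a ℕ.< n → b ℕ.≤ n → n ℕ.≤ a ℕ.+ b →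
                    v ≡ n ℕ.∸ b → v̄ ≡ n ℕ.∸ a ℕ.∸ 1 →
                    s ℕ.+ s̄ ℕ.+ a ℕ.* a ℕ.+ b ℕ.* b ℕ.+ n ℕ.+ a ℕ.* b ℕ.≤ (a ℕ.+ b) ℕ.* n ℕ.+ a ℕ.+ b →
                    ∀ {x y} → lowerBound n ≤ x → x < y →
                    gfun v v̄ (EF a v s) (EF b v̄ s̄) x < gfun v v̄ (EF a v s) (EF b v̄ s̄) y
  gfun-increasing {n} {a} {b} {s} {s̄} {v} {v̄} 2≤n a<n b≤n n≤a+b v≡ v̄≡ budget {x} {y} L≤x x<y =
    subst₂ _<_ (sym (gfun≡quartic v v̄ E F x)) (sym (gfun≡quartic v v̄ E F y))
      (quartic-increasing {d = E - F} (≤-trans (proj₂ at-L) (*-self-mono-≤ (proj₁ at-L) u[L]≤u[x]))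
                          (≤-trans (proj₁ at-L) u[L]≤u[x]) (u-mono-< {v} {v̄} x<y))
    where
    E F : ℚ
    E = EF a v s
    F = EF b v̄ s̄
    a+1≤n : a ℕ.+ 1 ℕ.≤ n
    a+1≤n = subst (ℕ._≤ n) (ℕP.+-comm 1 a) a<n
    qv : q v ≡ q n - q b
    qv = trans (cong q v≡) (q-∸ b≤n)
    qv̄ : q v̄ ≡ q n - (q a + q 1)
    qv̄ = trans (cong q (trans v̄≡ (ℕP.∸-+-assoc n a 1))) (trans (q-∸ a+1≤n) (cong (λ t → q n - t) (q-+ a 1)))
    U : ℚ
    U = u v v̄ (lowerBound n)
    at-L : 0ℚ ≤ U × E + F ≤ U * U
    at-L = E+F≤U² {q a} {q b} {q n} {q s} {q s̄} qv qv̄ (q-mono-≤ b≤n) (subst (_≤ q n) (q-+ a 1) (q-mono-≤ a+1≤n))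
             (subst (q n ≤_) (q-+ a b) (q-mono-≤ n≤a+b)) (q-mono-≤ 2≤n)
             (⟦⟧-mono-≤ (‵ s ⊕ ‵ s̄ ⊕ ‵ a ⊗ ‵ a ⊕ ‵ b ⊗ ‵ b ⊕ ‵ n ⊕ ‵ a ⊗ ‵ b) ((‵ a ⊕ ‵ b) ⊗ ‵ n ⊕ ‵ a ⊕ ‵ b) budget)
             (3*u[L]≡2n-1+3[a+b] {lowerBound n} {q n} {q a} {q b} (trans (3*lowerBound+5≡4n n) (q-* 4 n)) qv qv̄)
    u[L]≤u[x] : U ≤ u v v̄ x
    u[L]≤u[x] = u-mono-≤ {v} {v̄} L≤x

open import Data.Bool using (false)
open import Data.Nat using (ℕ; _∸_; _+_; s≤s; z≤n) renaming (_≤_ to _≤ℕ_)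
open import Data.Rational using (ℚ; _<_; _≤_)
open import Relation.Binary.PropositionalEquality using (_≡_)
open import Data.Nat.Properties using (≤-trans; <⇒≤)
open Counting using (cA≤n; cA<n; s+s̄-bound)
open Rational using (gfun-increasing; lowerBound≤⇒≤)

proposition6p4 : (n : ℕ) → 3 ≤ℕ n → (A : Mat n) → InSStar n A →
    lowerBound n ≤ q (cA A + cA (bar A)) →
    vA A ≡ n ∸ cA (bar A) →
    vA (bar A) ≡ n ∸ cA A ∸ 1 →
    (x y : ℚ) → lowerBound n ≤ x → x < y →
    gfun (vA A) (vA (bar A)) (EF (cA A) (vA A) (sA A)) (EF (cA (bar A)) (vA (bar A)) (sA (bar A))) x
      < gfun (vA A) (vA (bar A)) (EF (cA A) (vA A) (sA A)) (EF (cA (bar A)) (vA (bar A)) (sA (bar A))) y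
proposition6p4 n 3≤n A A∈𝒮* L≤a+b v≡ v̄≡ x y L≤x x<y =
  gfun-increasing {s = sA A} {s̄ = sA (bar A)}
    (<⇒≤ 3≤n) (cA<n A zero-diag (≤-trans (s≤s z≤n) 3≤n)) (cA≤n (bar A)) n≤a+b v≡ v̄≡
    (s+s̄-bound A zero-diag n≤a+b) L≤x x<y
  where
  zero-diag : ∀ i → A i i ≡ false
  zero-diag = InSStar.zeroDiag A∈𝒮*
  n≤a+b : n ≤ℕ cA A + cA (bar A)
  n≤a+b = lowerBound≤⇒≤ 3≤n L≤a+b
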